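{- Let $p$ be a prime and let $A=(a_{ij})$ be an $n\times n$ subring matrix with diagonal $(p^{e_1}, \ldots, p^{e_{n-1}}, 1)$, where $e_1,\dots,e_{n-1}\ge 0$. Let $I\subseteq\{1,\dots,n-1\}$ be the set of indices $j$ with $e_j \neq 0$. If $i \in I$ and $j \in\{1,\dots,n\}\setminus I$, then $a_{ij} \in \{0,1\}$.
   Context: For $u,w\in\mathbb Z^n$, $u\circ w$ is the componentwise product. An invertible matrix $A=(a_{ij})\in M_n(\mathbb Z)$ is in Hermite normal form if it is upper triangular and $0\le a_{ij}<a_{ii}$ for $1\le i<j\le n$. A subring matrix is an invertible integer matrix in Hermite normal form whose column span contains $(1,\dots,1)^T$ and is closed under $\circ$ (i.e. its column span is a subring of $\mathbb Z^n$). -}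

module Defs where

open import Data.Nat using (ℕ; zero; suc)
open import Data.Fin using (Fin; zero; suc; _<_)
open import Data.Integer using (ℤ; 0ℤ; 1ℤ; _+_; _*_; _≤_; _<_; +_)
open import Data.Product using (Σ; _×_)
open import Relation.Binary.PropositionalEquality using (_≡_)

Matrix : ℕ → Set
Matrix n = Fin n → Fin n → ℤ

Vector : ℕ → Set
Vector n = Fin n → ℤ

sumFin : ∀ {n} → (Fin n → ℤ) → ℤ
sumFin {zero}  f = 0ℤ
sumFin {suc n} f = f zero + sumFin (λ i → f (suc i))

_·_ : ∀ {n} → Matrix n → Vector n → Vector n
(A · x) r = sumFin (λ c → A r c * x c)

_∘ᶜ_ : ∀ {n} → Vector n → Vector n → Vector n
(u ∘ᶜ w) i = u i * w i

ones : ∀ {n} → Vector n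
ones _ = 1ℤ

InColSpan : ∀ {n} → Matrix n → Vector n → Set
InColSpan {n} A v = Σ (Vector n) (λ x → ∀ r → v r ≡ (A · x) r)

-- A is invertible (over ℚ): the map x ↦ A x on ℤ^n is injective,
-- equivalently det A ≠ 0.
Invertible : ∀ {n} → Matrix n → Set
Invertible {n} A = ∀ (x y : Vector n) → (∀ r → (A · x) r ≡ (A · y) r) → ∀ c → x c ≡ y c

UpperTriangular : ∀ {n} → Matrix n → Set
UpperTriangular A = ∀ i j → j Data.Fin.< i → A i j ≡ 0ℤ

IsHNF : ∀ {n} → Matrix n → Set
IsHNF A = Invertible A × UpperTriangular A
        × (∀ i j → i Data.Fin.< j → (0ℤ ≤ A i j) × (A i j Data.Integer.< A i i))

IsSubringMatrix : ∀ {n} → Matrix n → Set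
IsSubringMatrix A = IsHNF A × InColSpan A ones
                  × (∀ u w → InColSpan A u → InColSpan A w → InColSpan A (u ∘ᶜ w))

{-# OPTIONS --safe #-}
module Submission where

-- Let v be the column j with a_jj = 1; it is A e_j, so v ∘ v - v = A d for an
-- integer vector d.  Solve for d by back-substitution from the last row: if d
-- vanishes below row r, row r reads a_rr d_r = a_rj² - a_rj with a_rr = p^f.
-- Above the diagonal 0 ≤ a_rj < p^f, and as a_rj and a_rj - 1 are coprime the
-- prime power p^f divides one of them, forcing a_rj ∈ {0, 1}; then a_rj² = a_rj
-- and d_r = 0, so the induction continues.

open import Defs
open import Data.Nat as ℕ using (ℕ; zero; suc; _^_)
open import Data.Nat.Properties as ℕ using (*-comm; +-comm; m^n≢0)
open import Data.Nat.Divisibility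
  using ( _∣_; _∤_; divides-refl; _∣?_; 1∣_; m∣m*n; ∣-trans; *-monoʳ-∣; *-cancelˡ-∣; >⇒∤
        ; module ∣-Reasoning)
open import Data.Nat.Coprimality using (Coprime; coprime-+; 1-coprimeTo)
open import Data.Nat.Primality using (Prime; euclidsLemma; prime⇒nonZero; prime⇒nonTrivial)
open import Data.Nat.Solver using () renaming (module +-*-Solver to ℕ-Solver)
open import Data.Fin using (Fin; zero; suc; _<_; _>_; inject₁; fromℕ)
import Data.Fin.Properties as Fin
open import Data.Fin.Induction using (>-wellFounded)
open import Data.Fin.Relation.Unary.Top using (view; ‵fromℕ; ‵inject₁)
open import Data.Integer as ℤ using (ℤ; +_; 0ℤ; 1ℤ; +<+; _+_; _-_; _*_)
import Data.Integer.Properties as ℤ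
import Data.Integer.Divisibility as ℤ
open import Data.Integer.Divisibility.Signed using (divides; ∣⇒∣ᵤ)
open import Data.Integer.Solver using () renaming (module +-*-Solver to ℤ-Solver)
open import Data.Sum using (_⊎_; inj₁; inj₂)
open import Data.Product using (Σ; _×_; _,_; proj₁; proj₂)
open import Function using (_∘_)
open import Induction.WellFounded using (Acc; acc)
open import Relation.Nullary using (yes; no; contradiction)
open import Relation.Binary.Definitions using (tri<; tri≈; tri>)
open import Relation.Binary.PropositionalEquality
  using (_≡_; _≢_; refl; sym; trans; cong; cong₂; subst; module ≡-Reasoning)

IsZeroOrOne : ℤ → Set
IsZeroOrOne a = (a ≡ 0ℤ) ⊎ (a ≡ 1ℤ)

p^e∣m*n∧p∤m⇒p^e∣n : ∀ {p m n} e → Prime p → p ∤ m → p ^ e ∣ m ℕ.* n → p ^ e ∣ n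
p^e∣m*n∧p∤m⇒p^e∣n zero _ _ _ = 1∣ _
p^e∣m*n∧p∤m⇒p^e∣n {p} {m} {n} (suc e) p-prime p∤m p^[1+e]∣mn
  with euclidsLemma m n p-prime (∣-trans (m∣m*n (p ^ e)) p^[1+e]∣mn)
... | inj₁ p∣m = contradiction p∣m p∤m
... | inj₂ (divides-refl q) = begin
  p ℕ.* p ^ e ∣⟨ *-monoʳ-∣ p (p^e∣m*n∧p∤m⇒p^e∣n e p-prime p∤m p^e∣mq) ⟩
  p ℕ.* q     ≡⟨ *-comm p q ⟩
  q ℕ.* p     ∎
  where
  open ∣-Reasoning
  instance _ = prime⇒nonZero p-prime
  p^e∣mq : p ^ e ∣ m ℕ.* q
  p^e∣mq = *-cancelˡ-∣ p (begin
    p ℕ.* p ^ e     ∣⟨ p^[1+e]∣mn ⟩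
    m ℕ.* (q ℕ.* p) ≡⟨ solve 3 (λ m q p → m :* (q :* p) := p :* (m :* q)) refl m q p ⟩
    p ℕ.* (m ℕ.* q) ∎)
    where open ℕ-Solver

p^e∣m*n⇒p^e∣m⊎p^e∣n : ∀ {p m n} e → Prime p → Coprime m n →
                      p ^ e ∣ m ℕ.* n → p ^ e ∣ m ⊎ p ^ e ∣ n
p^e∣m*n⇒p^e∣m⊎p^e∣n {p} {m} {n} e p-prime m⊥n p^e∣mn with p ∣? m
... | no p∤m = inj₂ (p^e∣m*n∧p∤m⇒p^e∣n e p-prime p∤m p^e∣mn)
... | yes p∣m =
  inj₁ (p^e∣m*n∧p∤m⇒p^e∣n e p-prime p∤n (subst (p ^ e ∣_) (*-comm m n) p^e∣mn))
  where
  p∤n : p ∤ n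
  p∤n p∣n = ℕ.nonTrivial⇒≢1 {{prime⇒nonTrivial p-prime}} (m⊥n (p∣m , p∣n))

coprime-suc : ∀ n → Coprime (suc n) n
coprime-suc n = subst (λ m → Coprime m n) (+-comm n 1) (coprime-+ (1-coprimeTo n))

p^e∣[1+n]*n⇒n≡0 : ∀ {p n} e → Prime p → suc n ℕ.< p ^ e → p ^ e ∣ suc n ℕ.* n → n ≡ 0
p^e∣[1+n]*n⇒n≡0 {n = zero} _ _ _ _ = refl
p^e∣[1+n]*n⇒n≡0 {n = suc n} e p-prime 2+n<p^e p^e∣product
  with p^e∣m*n⇒p^e∣m⊎p^e∣n e p-prime (coprime-suc (suc n)) p^e∣product
... | inj₁ p^e∣2+n = contradiction p^e∣2+n (>⇒∤ 2+n<p^e)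
... | inj₂ p^e∣1+n = contradiction p^e∣1+n (>⇒∤ (ℕ.<-trans (ℕ.n<1+n (suc n)) 2+n<p^e))

[1+n]²-[1+n]≡[1+n]*n : ∀ n → + suc n * + suc n - + suc n ≡ + (suc n ℕ.* n)
[1+n]²-[1+n]≡[1+n]*n n = begin
  + suc n * + suc n - + suc n  ≡⟨ solve 1 (λ a → a :* a :- a := a :* (a :- con 1ℤ)) refl (+ suc n) ⟩
  + suc n * (+ suc n - 1ℤ)     ≡⟨⟩
  + suc n * + n                ≡⟨ ℤ.pos-* (suc n) n ⟨
  + (suc n ℕ.* n)                  ∎
  where open ≡-Reasoning; open ℤ-Solver

idempotent-mod-prime-power : ∀ {p a} e → Prime p → 0ℤ ℤ.≤ a → a ℤ.< + (p ^ e) →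
                             + (p ^ e) ℤ.∣ a * a - a → IsZeroOrOne a
idempotent-mod-prime-power {a = + zero} _ _ _ _ _ = inj₁ refl
idempotent-mod-prime-power {p} {+ suc n} e p-prime _ (+<+ 1+n<p^e) p^e∣a²-a
  with p^e∣[1+n]*n⇒n≡0 e p-prime 1+n<p^e
         (subst (p ^ e ∣_) (cong ℤ.∣_∣ ([1+n]²-[1+n]≡[1+n]*n n)) p^e∣a²-a)
... | refl = inj₂ refl

sumFin-cong : ∀ {n} {f g : Fin n → ℤ} → (∀ t → f t ≡ g t) → sumFin f ≡ sumFin g
sumFin-cong {zero}  f≗g = refl
sumFin-cong {suc n} f≗g = cong₂ _+_ (f≗g zero) (sumFin-cong (λ t → f≗g (suc t)))

sumFin-zero : ∀ {n} {f : Fin n → ℤ} → (∀ t → f t ≡ 0ℤ) → sumFin f ≡ 0ℤ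
sumFin-zero {zero}  f≗0 = refl
sumFin-zero {suc n} f≗0 = cong₂ _+_ (f≗0 zero) (sumFin-zero (λ t → f≗0 (suc t)))

sumFin-single : ∀ {n} {f : Fin n → ℤ} s → (∀ t → t ≢ s → f t ≡ 0ℤ) → sumFin f ≡ f s
sumFin-single {suc n} {f} zero f≗0 = begin
  f zero + sumFin (λ t → f (suc t)) ≡⟨ cong (_+_ (f zero)) (sumFin-zero (λ t → f≗0 (suc t) λ ())) ⟩
  f zero + 0ℤ                       ≡⟨ ℤ.+-identityʳ (f zero) ⟩
  f zero                            ∎
  where open ≡-Reasoning
sumFin-single {suc n} {f} (suc s) f≗0 = begin
  f zero + sumFin (λ t → f (suc t))
    ≡⟨ cong₂ _+_ (f≗0 zero λ ()) (sumFin-single s λ t t≢s → f≗0 (suc t) (t≢s ∘ Fin.suc-injective)) ⟩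
  0ℤ + f (suc s)
    ≡⟨ ℤ.+-identityˡ (f (suc s)) ⟩
  f (suc s)
    ∎
  where open ≡-Reasoning

sumFin-minus : ∀ {n} (f g : Fin n → ℤ) → sumFin (λ t → f t - g t) ≡ sumFin f - sumFin g
sumFin-minus {zero}  f g = refl
sumFin-minus {suc n} f g = begin
  (f zero - g zero) + sumFin (λ t → f (suc t) - g (suc t))
    ≡⟨ cong (_+_ (f zero - g zero)) (sumFin-minus (λ t → f (suc t)) (λ t → g (suc t))) ⟩
  (f zero - g zero) + (Σf - Σg)
    ≡⟨ solve 4 (λ a b c d → (a :- b) :+ (c :- d) := (a :+ c) :- (b :+ d)) refl (f zero) (g zero) Σf Σg ⟩
  (f zero + Σf) - (g zero + Σg)
    ∎
  where
  open ≡-Reasoning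
  open ℤ-Solver
  Σf = sumFin (λ t → f (suc t))
  Σg = sumFin (λ t → g (suc t))

unitVector : ∀ {n} → Fin n → Vector n
unitVector zero    zero    = 1ℤ
unitVector zero    (suc t) = 0ℤ
unitVector (suc j) zero    = 0ℤ
unitVector (suc j) (suc t) = unitVector j t

sumFin-*-unitVector : ∀ {n} (f : Fin n → ℤ) j → sumFin (λ t → f t * unitVector j t) ≡ f j
sumFin-*-unitVector f zero = begin
  f zero * 1ℤ + sumFin (λ t → f (suc t) * 0ℤ)
    ≡⟨ cong₂ _+_ (ℤ.*-identityʳ (f zero)) (sumFin-zero (λ t → ℤ.*-zeroʳ (f (suc t)))) ⟩
  f zero + 0ℤ
    ≡⟨ ℤ.+-identityʳ (f zero) ⟩
  f zero
    ∎
  where open ≡-Reasoning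
sumFin-*-unitVector f (suc j) = begin
  f zero * 0ℤ + sumFin (λ t → f (suc t) * unitVector j t)
    ≡⟨ cong₂ _+_ (ℤ.*-zeroʳ (f zero)) (sumFin-*-unitVector (λ t → f (suc t)) j) ⟩
  0ℤ + f (suc j)
    ≡⟨ ℤ.+-identityˡ (f (suc j)) ⟩
  f (suc j)
    ∎
  where open ≡-Reasoning

module _ {n} (A : Matrix n) where

  ·-unitVector : ∀ j r → (A · unitVector j) r ≡ A r j
  ·-unitVector j r = sumFin-*-unitVector (A r) j

  column∈colSpan : ∀ j → InColSpan A (λ r → A r j)
  column∈colSpan j = unitVector j , λ r → sym (·-unitVector j r)

  ·-minus : ∀ x y r → (A · (λ t → x t - y t)) r ≡ (A · x) r - (A · y) r
  ·-minus x y r = trans (sumFin-cong λ t → distrib (A r t) (x t) (y t))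
                        (sumFin-minus (λ t → A r t * x t) (λ t → A r t * y t))
    where
    open ℤ-Solver
    distrib : ∀ a b c → a * (b - c) ≡ a * b - a * c
    distrib = solve 3 (λ a b c → a :* (b :- c) := a :* b :- a :* c) refl

  ·-upperTriangular : UpperTriangular A → ∀ x r → (∀ t → r < t → x t ≡ 0ℤ) →
                      (A · x) r ≡ A r r * x r
  ·-upperTriangular upper x r x-vanishes = sumFin-single r vanishes
    where
    vanishes : ∀ t → t ≢ r → A r t * x t ≡ 0ℤ
    vanishes t t≢r with Fin.<-cmp t r
    ... | tri< t<r _ _ = trans (cong (_* x t) (upper r t t<r)) (ℤ.*-zeroˡ (x t))
    ... | tri≈ _ t≡r _ = contradiction t≡r t≢r
    ... | tri> _ _ r<t = trans (cong (A r t *_) (x-vanishes t r<t)) (ℤ.*-zeroʳ (A r t))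

IsZeroOrOne-idempotent : ∀ {a} → IsZeroOrOne a → a * a - a ≡ 0ℤ
IsZeroOrOne-idempotent (inj₁ refl) = refl
IsZeroOrOne-idempotent (inj₂ refl) = refl

unitPivotColumn-isZeroOrOne :
  ∀ {n p} → Prime p → {A : Matrix n} → UpperTriangular A →
  (∀ i j → i < j → (0ℤ ℤ.≤ A i j) × (A i j ℤ.< A i i)) →
  (∀ u w → InColSpan A u → InColSpan A w → InColSpan A (u ∘ᶜ w)) →
  (∀ r → Σ ℕ λ f → A r r ≡ + (p ^ f)) →
  ∀ {j} → A j j ≡ 1ℤ → ∀ r → IsZeroOrOne (A r j)
unitPivotColumn-isZeroOrOne {n} {p} p-prime {A} upper reduced closed diagonal {j} pivot r =
  proj₁ (rows r (>-wellFounded r))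
  where
  instance _ = prime⇒nonZero p-prime

  column : Vector n
  column r = A r j

  square : Vector n
  square = proj₁ (closed column column (column∈colSpan A j) (column∈colSpan A j))

  defect : Vector n
  defect t = square t - unitVector j t

  A·defect : ∀ r → (A · defect) r ≡ column r * column r - column r
  A·defect r = begin
    (A · defect) r                        ≡⟨ ·-minus A square (unitVector j) r ⟩
    (A · square) r - (A · unitVector j) r
      ≡⟨ cong₂ _-_ (sym (proj₂ (closed column column _ _) r)) (·-unitVector A j r) ⟩
    column r * column r - column r        ∎
    where open ≡-Reasoning

  row : ∀ r → (∀ s → r < s → defect s ≡ 0ℤ) → IsZeroOrOne (A r j) × (defect r ≡ 0ℤ)
  row r below with diagonal r
  ... | f , Arr≡p^f = entry , defect≡0
    where
    p^f*defect : + (p ^ f) * defect r ≡ column r * column r - column r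
    p^f*defect = begin
      + (p ^ f) * defect r           ≡⟨ cong (_* defect r) Arr≡p^f ⟨
      A r r * defect r               ≡⟨ ·-upperTriangular A upper defect r below ⟨
      (A · defect) r                 ≡⟨ A·defect r ⟩
      column r * column r - column r ∎
      where open ≡-Reasoning

    entry : IsZeroOrOne (A r j)
    entry with Fin.<-cmp r j
    ... | tri< r<j _ _ = let (0≤Arj , Arj<Arr) = reduced r j r<j in
          idempotent-mod-prime-power f p-prime 0≤Arj (subst (A r j ℤ.<_) Arr≡p^f Arj<Arr)
            (∣⇒∣ᵤ (divides (defect r) (trans (sym p^f*defect) (ℤ.*-comm (+ (p ^ f)) (defect r)))))
    ... | tri≈ _ refl _ = inj₂ pivot
    ... | tri> _ _ j<r = inj₁ (upper r j j<r)

    defect≡0 : defect r ≡ 0ℤ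
    defect≡0 = ℤ.*-cancelˡ-≡ (+ (p ^ f)) (defect r) 0ℤ {{m^n≢0 p f}} (begin
      + (p ^ f) * defect r           ≡⟨ p^f*defect ⟩
      column r * column r - column r ≡⟨ IsZeroOrOne-idempotent entry ⟩
      0ℤ                             ≡⟨ ℤ.*-zeroʳ (+ (p ^ f)) ⟨
      + (p ^ f) * 0ℤ                 ∎)
      where open ≡-Reasoning

  rows : ∀ r → Acc _>_ r → IsZeroOrOne (A r j) × (defect r ≡ 0ℤ)
  rows r (acc rec) = row r λ s r<s → proj₂ (rows s (rec r<s))

proposition4p9 : (p m : ℕ) → Prime p → (e : Fin m → ℕ) → (A : Matrix (suc m))
    → IsSubringMatrix A
    → (∀ k → A (inject₁ k) (inject₁ k) ≡ + (p ^ e k))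
    → A (fromℕ m) (fromℕ m) ≡ 1ℤ
    → (i : Fin m) → e i ≢ 0
    → (j : Fin (suc m)) → (j ≡ fromℕ m ⊎ Σ (Fin m) (λ k → (j ≡ inject₁ k) × (e k ≡ 0)))
    → (A (inject₁ i) j ≡ 0ℤ) ⊎ (A (inject₁ i) j ≡ 1ℤ)
-- The hypothesis e i ≢ 0 is not needed: every entry of column j is 0 or 1.
proposition4p9 p m p-prime e A ((_ , upper , reduced) , _ , closed) diag-inject diag-last i _ j j∉I =
  unitPivotColumn-isZeroOrOne p-prime upper reduced closed diagonal (pivot j∉I) (inject₁ i)
  where
  diagonal : ∀ r → Σ ℕ λ f → A r r ≡ + (p ^ f)
  diagonal r with view r
  ... | ‵fromℕ      = 0 , diag-last
  ... | ‵inject₁ k = e k , diag-inject k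

  pivot : (j ≡ fromℕ m ⊎ Σ (Fin m) (λ k → (j ≡ inject₁ k) × (e k ≡ 0))) → A j j ≡ 1ℤ
  pivot (inj₁ refl)             = diag-last
  pivot (inj₂ (k , refl , e≡0)) = trans (diag-inject k) (cong (λ f → + (p ^ f)) e≡0)
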